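{- Let $A$ be the $3\times 18$ matrix with columns $a_1,\dots,a_6,d_1,\dots,d_{12}$ as in the context, $K=\{w\in\mathbb{Z}_+^{18}: Aw=0\}$, and $H$ the unique minimal Hilbert basis of $K$. Let $v$ be any vector in the orbit (under the group $G$ described in the context) of one of the eight vectors $a_1+a_4$, $d_1+d_4$, $a_1+d_3+d_4$, $d_1+d_7+d_{12}$, $a_1+d_4+d_8+d_9$, $d_1+d_2+d_7+d_8$, $a_4+a_5+d_1+d_5+d_{10}$, $a_1+a_2+a_3+d_4+d_8+d_{12}$. If $u\in\mathbb{Z}_+^{18}$, $u\neq v$ and $supp(v)\subseteq supp(u)$, then $u\notin H$.
   Context: Columns of $A$: $a_1=(2,0,0)^T$, $a_2=(0,2,0)^T$, $a_3=(0,0,2)^T$, $a_4=(-2,0,0)^T$, $a_5=(0,-2,0)^T$, $a_6=(0,0,-2)^T$, $d_1=(1,1,0)^T$, $d_2=(1,-1,0)^T$, $d_3=(-1,1,0)^T$, $d_4=(-1,-1,0)^T$, $d_5=(1,0,1)^T$, $d_6=(1,0,-1)^T$, $d_7=(-1,0,1)^T$, $d_8=(-1,0,-1)^T$, $d_9=(0,1,1)^T$, $d_{10}=(0,1,-1)^T$, $d_{11}=(0,-1,1)^T$, $d_{12}=(0,-1,-1)^T$. Coordinates $w_1,\dots,w_6$ of $w\in\mathbb{Z}_+^{18}$ correspond to $a_1,\dots,a_6$ and $w_7,\dots,w_{18}$ to $d_1,\dots,d_{12}$; a formal sum like $a_1+d_3+d_4$ denotes the vector with $w_1=w_9=w_{10}=1$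 and other coordinates $0$. $supp(w)=\{i: w_i>0\}$. A Hilbert basis of $K$ is a finite subset $B\subseteq K$ such that every element of $K$ is a non-negative integer combination of elements of $B$; $H$ is the unique inclusion-minimal one (the nonzero elements of $K$ that are not sums of two nonzero elements of $K$). $G$ is the group of the 48 signed permutation matrices $P$ on $\mathbb{R}^3$; each $P$ permutes the columns of $A$, inducing a permutation $\sigma_P$ of $\{1,\dots,18\}$ with $PA_{\cdot j}=A_{\cdot\sigma_P(j)}$, and acts on $\mathbb{Z}_+^{18}$ by $(P\cdot w)_{\sigma_P(j)}=w_j$; the orbit of $w$ is $\{P\cdot w: P\in G\}$. -}

module Defs where

open import Data.Nat using (ℕ; zero; suc; _<_)
open import Data.Integer as ℤ using (ℤ; +_; -[1+_])
open import Data.Fin using (Fin; zero; suc; _≟_; _↑ˡ_; _↑ʳ_)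
open import Data.Fin.Permutation using (Permutation′; _⟨$⟩ʳ_)
open import Data.Vec using (Vec; []; _∷_; lookup; tabulate; zipWith; replicate; foldr)
open import Data.List using (List; []; _∷_)
open import Data.Sign using (Sign)
open import Data.Product using (Σ; ∃; ∃-syntax; _×_; _,_)
open import Relation.Nullary using (¬_; yes; no)
open import Relation.Binary.PropositionalEquality using (_≡_)

ℤ³ : Set
ℤ³ = Vec ℤ 3

ℕ¹⁸ : Set
ℕ¹⁸ = Vec ℕ 18

-- the 18 columns of A (index 0..5 ↦ a₁..a₆, index 6..17 ↦ d₁..d₁₂)
col : Fin 18 → ℤ³
col i = lookup cols i
  where
  p2 = + 2 ; m2 = -[1+ 1 ] ; p1 = + 1 ; m1 = -[1+ 0 ] ; z = + 0
  cols : Vec ℤ³ 18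
  cols =
      (p2 ∷ z ∷ z ∷ []) ∷ (z ∷ p2 ∷ z ∷ []) ∷ (z ∷ z ∷ p2 ∷ [])
    ∷ (m2 ∷ z ∷ z ∷ []) ∷ (z ∷ m2 ∷ z ∷ []) ∷ (z ∷ z ∷ m2 ∷ [])
    ∷ (p1 ∷ p1 ∷ z ∷ []) ∷ (p1 ∷ m1 ∷ z ∷ []) ∷ (m1 ∷ p1 ∷ z ∷ []) ∷ (m1 ∷ m1 ∷ z ∷ [])
    ∷ (p1 ∷ z ∷ p1 ∷ []) ∷ (p1 ∷ z ∷ m1 ∷ []) ∷ (m1 ∷ z ∷ p1 ∷ []) ∷ (m1 ∷ z ∷ m1 ∷ [])
    ∷ (z ∷ p1 ∷ p1 ∷ []) ∷ (z ∷ p1 ∷ m1 ∷ []) ∷ (z ∷ m1 ∷ p1 ∷ []) ∷ (z ∷ m1 ∷ m1 ∷ [])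
    ∷ []

A : Fin 3 → Fin 18 → ℤ
A i j = lookup (col j) i

sumℤ : ∀ {n} → Vec ℤ n → ℤ
sumℤ = foldr _ ℤ._+_ (+ 0)

Aw : ℕ¹⁸ → Fin 3 → ℤ
Aw w i = sumℤ (tabulate λ j → A i j ℤ.* (+ lookup w j))

InK : ℕ¹⁸ → Set
InK w = ∀ i → Aw w i ≡ + 0

zero¹⁸ : ℕ¹⁸
zero¹⁸ = replicate 18 0

_⊕_ : ℕ¹⁸ → ℕ¹⁸ → ℕ¹⁸
_⊕_ = zipWith Data.Nat._+_

InH : ℕ¹⁸ → Set
InH w = InK w × ¬ (w ≡ zero¹⁸)
      × ¬ (Σ ℕ¹⁸ λ x → Σ ℕ¹⁸ λ y →
             InK x × ¬ (x ≡ zero¹⁸) × InK y × ¬ (y ≡ zero¹⁸) × w ≡ x ⊕ y)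

_⊆supp_ : ℕ¹⁸ → ℕ¹⁸ → Set
v ⊆supp u = ∀ i → 0 < lookup v i → 0 < lookup u i

-- Signed permutation matrices on ℝ³: P = signedPerm π ε, with
-- P i j = ε i if j = π i, and 0 otherwise.  These are exactly the 48 elements of G.
signℤ : Sign → ℤ
signℤ Sign.+ = + 1
signℤ Sign.- = -[1+ 0 ]

SignedPerm : Set
SignedPerm = Permutation′ 3 × (Fin 3 → Sign)

matrix : SignedPerm → Fin 3 → Fin 3 → ℤ
matrix (π , ε) i j with j ≟ (π ⟨$⟩ʳ i)
... | yes _ = signℤ (ε i)
... | no _ = + 0

_·ℤ³_ : SignedPerm → ℤ³ → ℤ³
P ·ℤ³ x = tabulate λ i → sumℤ (tabulate λ j → matrix P i j ℤ.* lookup x j)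

Induces : SignedPerm → (Fin 18 → Fin 18) → Set
Induces P σ = ∀ j → P ·ℤ³ col j ≡ col (σ j)

-- v = P · w, i.e. v_{σ_P(j)} = w_j for all j
InOrbit : ℕ¹⁸ → ℕ¹⁸ → Set
InOrbit w v = Σ SignedPerm λ P → Σ (Fin 18 → Fin 18) λ σ →
              Induces P σ × (∀ j → lookup v (σ j) ≡ lookup w j)

a : Fin 6 → Fin 18
a i = i ↑ˡ 12

d : Fin 12 → Fin 18
d i = 6 ↑ʳ i

formal : List (Fin 18) → ℕ¹⁸
formal [] = zero¹⁸
formal (i ∷ is) = tabulate (λ j → ind j) ⊕ formal is
  where
  ind : Fin 18 → ℕ
  ind j with j ≟ i
  ... | yes _ = 1
  ... | no _ = 0

-- the eight orbit representatives (a 0 = a₁, d 0 = d₁, etc.)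
reps : List ℕ¹⁸
reps =
    formal (a (# 0) ∷ a (# 3) ∷ [])
  ∷ formal (d (# 0) ∷ d (# 3) ∷ [])
  ∷ formal (a (# 0) ∷ d (# 2) ∷ d (# 3) ∷ [])
  ∷ formal (d (# 0) ∷ d (# 6) ∷ d (# 11) ∷ [])
  ∷ formal (a (# 0) ∷ d (# 3) ∷ d (# 7) ∷ d (# 8) ∷ [])
  ∷ formal (d (# 0) ∷ d (# 1) ∷ d (# 6) ∷ d (# 7) ∷ [])
  ∷ formal (a (# 3) ∷ a (# 4) ∷ d (# 0) ∷ d (# 4) ∷ d (# 9) ∷ [])
  ∷ formal (a (# 0) ∷ a (# 1) ∷ a (# 2) ∷ d (# 3) ∷ d (# 7) ∷ d (# 11) ∷ [])
  ∷ []
  where open import Data.Fin using (#_)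

module Submission where

-- Every representative w is a nonzero 0/1 vector of K, and so is every v in its orbit: the
-- signed permutation P permutes the (pairwise distinct) columns of A, so (A v)ᵢ = ±(A w)_{π i}.
-- For such v, supp v ⊆ supp u means v ≤ u coordinatewise, so u = v + (u − v) with u − v ∈ K,
-- and u − v ≠ 0 unless u = v; hence u is not in the minimal Hilbert basis.

open import Defs
open import Data.Nat as ℕ using (ℕ; _≤_; z≤n; s≤s)
import Data.Nat.Properties as ℕP
open import Data.Integer as ℤ using (ℤ; +_; _+_; _*_)
import Data.Integer.Properties as ℤP
open import Data.Fin using (Fin; zero; suc; _≟_; punchIn; punchOut)
import Data.Fin.Properties as FinP
open import Data.Fin.Permutation using (Permutation′; permutation; _⟨$⟩ʳ_; _⟨$⟩ˡ_; inverseʳ)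
open import Data.Vec using (Vec; lookup; tabulate; zipWith)
import Data.Vec.Properties as VecP
open import Data.Vec.Functional using (Vector)
open import Data.Sign using (Sign)
open import Data.List.Membership.Propositional using (_∈_)
import Data.List.Relation.Unary.All as All
open import Data.Product using (∃; _×_; _,_; proj₁; proj₂)
open import Function using (_∘_; Injective)
open import Relation.Nullary using (¬_; yes; no; ¬?; contradiction)
open import Relation.Nullary.Decidable using (_×-dec_; _→-dec_; from-yes)
open import Relation.Binary.PropositionalEquality

import Algebra.Properties.Semiring.Sum ℤP.+-*-semiring as ∑ℤ
open ∑ℤ using (sum)

sumℤ-tabulate : ∀ {n} (f : Vector ℤ n) → sumℤ (tabulate f) ≡ sum f
sumℤ-tabulate {ℕ.zero} f = refl
sumℤ-tabulate {ℕ.suc n} f = cong (λ s → f zero + s) (sumℤ-tabulate (f ∘ suc))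

sum-single : ∀ {n} (f : Vector ℤ (ℕ.suc n)) k → (∀ j → j ≢ k → f j ≡ + 0) → sum f ≡ f k
sum-single {n} f k off = begin
  sum f                      ≡⟨ ∑ℤ.sum-remove {i = k} f ⟩
  f k + sum (f ∘ punchIn k)  ≡⟨ cong (λ s → f k + s) (∑ℤ.sum-cong-≗ (λ j → off _ (FinP.punchInᵢ≢i k j))) ⟩
  f k + sum {n} (λ _ → + 0)  ≡⟨ cong (λ s → f k + s) (∑ℤ.sum-replicate-zero n) ⟩
  f k + + 0                  ≡⟨ ℤP.+-identityʳ (f k) ⟩
  f k                        ∎
  where open ≡-Reasoning

lookup-ext : ∀ {X : Set} {n} {x y : Vec X n} → (∀ k → lookup x k ≡ lookup y k) → x ≡ y
lookup-ext {x = x} {y} x≗y = begin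
  x                    ≡⟨ VecP.tabulate∘lookup x ⟨
  tabulate (lookup x)  ≡⟨ VecP.tabulate-cong x≗y ⟩
  tabulate (lookup y)  ≡⟨ VecP.tabulate∘lookup y ⟩
  y                    ∎
  where open ≡-Reasoning

injective⇒surjective : ∀ {n} {f : Fin n → Fin n} → Injective _≡_ _≡_ f → ∀ k → ∃ λ j → f j ≡ k
injective⇒surjective {ℕ.suc n} {f} f-inj k with FinP.any? (λ j → f j FinP.≟ k)
... | yes hit  = hit
... | no  miss = contradiction (FinP.injective⇒≤ g-inj) ℕP.1+n≰n
  where
  k≢f : ∀ j → k ≢ f j
  k≢f j k≡fj = miss (j , sym k≡fj)
  g : Fin (ℕ.suc n) → Fin n
  g j = punchOut (k≢f j)
  g-inj : Injective _≡_ _≡_ g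
  g-inj {i} {j} gi≡gj = f-inj (FinP.punchOut-injective (k≢f i) (k≢f j) gi≡gj)

Aw-sum : ∀ w i → Aw w i ≡ sum (λ j → A i j * + lookup w j)
Aw-sum w i = sumℤ-tabulate (λ j → A i j * + lookup w j)

Aw-⊕ : ∀ x y i → Aw (x ⊕ y) i ≡ Aw x i + Aw y i
Aw-⊕ x y i = begin
  Aw (x ⊕ y) i
    ≡⟨ Aw-sum (x ⊕ y) i ⟩
  sum (λ j → A i j * + lookup (x ⊕ y) j)
    ≡⟨ ∑ℤ.sum-cong-≗ distrib ⟩
  sum (λ j → A i j * + lookup x j + A i j * + lookup y j)
    ≡⟨ ∑ℤ.∑-distrib-+ (λ j → A i j * + lookup x j) (λ j → A i j * + lookup y j) ⟩
  sum (λ j → A i j * + lookup x j) + sum (λ j → A i j * + lookup y j)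
    ≡⟨ cong₂ _+_ (Aw-sum x i) (Aw-sum y i) ⟨
  Aw x i + Aw y i
    ∎
  where
  open ≡-Reasoning
  distrib : ∀ j → A i j * + lookup (x ⊕ y) j ≡ A i j * + lookup x j + A i j * + lookup y j
  distrib j rewrite VecP.lookup-zipWith ℕ._+_ j x y =
    trans (cong (A i j *_) (ℤP.pos-+ (lookup x j) (lookup y j))) (ℤP.*-distribˡ-+ (A i j) _ _)

InK-cancelˡ : ∀ x y → InK (x ⊕ y) → InK x → InK y
InK-cancelˡ x y Kx⊕y Kx i = begin
  Aw y i           ≡⟨ ℤP.+-identityˡ (Aw y i) ⟨
  + 0 + Aw y i     ≡⟨ cong (_+ Aw y i) (Kx i) ⟨
  Aw x i + Aw y i  ≡⟨ Aw-⊕ x y i ⟨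
  Aw (x ⊕ y) i     ≡⟨ Kx⊕y i ⟩
  + 0              ∎
  where open ≡-Reasoning

_≼_ : ℕ¹⁸ → ℕ¹⁸ → Set
v ≼ u = ∀ k → lookup v k ≤ lookup u k

_⊖_ : ℕ¹⁸ → ℕ¹⁸ → ℕ¹⁸
_⊖_ = zipWith ℕ._∸_

⊕-⊖ : ∀ v u → v ≼ u → v ⊕ (u ⊖ v) ≡ u
⊕-⊖ v u v≼u = lookup-ext λ k → begin
  lookup (v ⊕ (u ⊖ v)) k                      ≡⟨ VecP.lookup-zipWith ℕ._+_ k v (u ⊖ v) ⟩
  lookup v k ℕ.+ lookup (u ⊖ v) k             ≡⟨ cong (lookup v k ℕ.+_) (VecP.lookup-zipWith ℕ._∸_ k u v) ⟩
  lookup v k ℕ.+ (lookup u k ℕ.∸ lookup v k)  ≡⟨ ℕP.m+[n∸m]≡n (v≼u k) ⟩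
  lookup u k                                  ∎
  where open ≡-Reasoning

⊕-identityʳ : ∀ v → v ⊕ zero¹⁸ ≡ v
⊕-identityʳ v = lookup-ext λ k → begin
  lookup (v ⊕ zero¹⁸) k           ≡⟨ VecP.lookup-zipWith ℕ._+_ k v zero¹⁸ ⟩
  lookup v k ℕ.+ lookup zero¹⁸ k  ≡⟨ cong (lookup v k ℕ.+_) (VecP.lookup-replicate k 0) ⟩
  lookup v k ℕ.+ 0                ≡⟨ ℕP.+-identityʳ (lookup v k) ⟩
  lookup v k                      ∎
  where open ≡-Reasoning

¬InH-above : ∀ {v u} → InK v → v ≢ zero¹⁸ → v ≼ u → u ≢ v → ¬ InH u
¬InH-above {v} {u} Kv v≢0 v≼u u≢v (Ku , _ , indecomposable) =
  indecomposable (v , u ⊖ v , Kv , v≢0 , K[u⊖v] , u⊖v≢0 , sym (⊕-⊖ v u v≼u))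
  where
  K[u⊖v] : InK (u ⊖ v)
  K[u⊖v] = InK-cancelˡ v (u ⊖ v) (subst InK (sym (⊕-⊖ v u v≼u)) Ku) Kv
  u⊖v≢0 : u ⊖ v ≢ zero¹⁸
  u⊖v≢0 u⊖v≡0 = u≢v (begin
    u              ≡⟨ ⊕-⊖ v u v≼u ⟨
    v ⊕ (u ⊖ v)    ≡⟨ cong (v ⊕_) u⊖v≡0 ⟩
    v ⊕ zero¹⁸     ≡⟨ ⊕-identityʳ v ⟩
    v              ∎)
    where open ≡-Reasoning

ZeroOne : ℕ¹⁸ → Set
ZeroOne v = ∀ k → lookup v k ≤ 1

zeroOne-⊆supp⇒≼ : ∀ {v u} → ZeroOne v → v ⊆supp u → v ≼ u
zeroOne-⊆supp⇒≼ {v} {u} v≤1 v⊆u k with lookup v k | v≤1 k | v⊆u k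
... | 0               | _      | _         = z≤n
... | 1               | _      | 0<vk⇒0<uk = 0<vk⇒0<uk (s≤s z≤n)
... | ℕ.suc (ℕ.suc _) | s≤s () | _

matrix-on : ∀ π ε i → matrix (π , ε) i (π ⟨$⟩ʳ i) ≡ signℤ (ε i)
matrix-on π ε i with (π ⟨$⟩ʳ i) ≟ (π ⟨$⟩ʳ i)
... | yes _  = refl
... | no  ≢  = contradiction refl ≢

matrix-off : ∀ π ε i j → j ≢ π ⟨$⟩ʳ i → matrix (π , ε) i j ≡ + 0
matrix-off π ε i j j≢πi with j ≟ (π ⟨$⟩ʳ i)
... | yes j≡πi = contradiction j≡πi j≢πi
... | no  _    = refl

·-lookup : ∀ π ε x i → lookup ((π , ε) ·ℤ³ x) i ≡ signℤ (ε i) * lookup x (π ⟨$⟩ʳ i)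
·-lookup π ε x i = begin
  lookup ((π , ε) ·ℤ³ x) i           ≡⟨ VecP.lookup∘tabulate (λ i → sumℤ (tabulate (row i))) i ⟩
  sumℤ (tabulate (row i))            ≡⟨ sumℤ-tabulate (row i) ⟩
  sum (row i)                        ≡⟨ sum-single (row i) (π ⟨$⟩ʳ i) off-diagonal ⟩
  row i (π ⟨$⟩ʳ i)                   ≡⟨ cong (_* lookup x (π ⟨$⟩ʳ i)) (matrix-on π ε i) ⟩
  signℤ (ε i) * lookup x (π ⟨$⟩ʳ i)  ∎
  where
  open ≡-Reasoning
  row : Fin 3 → Fin 3 → ℤ
  row i j = matrix (π , ε) i j * lookup x j
  off-diagonal : ∀ j → j ≢ π ⟨$⟩ʳ i → row i j ≡ + 0
  off-diagonal j j≢πi = trans (cong (_* lookup x j) (matrix-off π ε i j j≢πi)) (ℤP.*-zeroˡ (lookup x j))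

signℤ-cancel : ∀ s {x y} → signℤ s * x ≡ signℤ s * y → x ≡ y
signℤ-cancel Sign.+ = ℤP.*-cancelˡ-≡ (signℤ Sign.+) _ _
signℤ-cancel Sign.- = ℤP.*-cancelˡ-≡ (signℤ Sign.-) _ _

·-injective : ∀ P {x y} → P ·ℤ³ x ≡ P ·ℤ³ y → x ≡ y
·-injective (π , ε) {x} {y} Px≡Py = lookup-ext λ k →
  subst (λ k → lookup x k ≡ lookup y k) (inverseʳ π) (signℤ-cancel (ε (π ⟨$⟩ˡ k)) (begin
    signℤ (ε (π ⟨$⟩ˡ k)) * lookup x (π ⟨$⟩ʳ (π ⟨$⟩ˡ k)) ≡⟨ ·-lookup π ε x (π ⟨$⟩ˡ k) ⟨
    lookup ((π , ε) ·ℤ³ x) (π ⟨$⟩ˡ k)                   ≡⟨ cong (λ z → lookup z (π ⟨$⟩ˡ k)) Px≡Py ⟩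
    lookup ((π , ε) ·ℤ³ y) (π ⟨$⟩ˡ k)                   ≡⟨ ·-lookup π ε y (π ⟨$⟩ˡ k) ⟩
    signℤ (ε (π ⟨$⟩ˡ k)) * lookup y (π ⟨$⟩ʳ (π ⟨$⟩ˡ k)) ∎))
  where open ≡-Reasoning

col-injective : Injective _≡_ _≡_ col
col-injective {j} {j′} = from-yes (FinP.all? λ j → FinP.all? λ j′ →
  VecP.≡-dec ℤ._≟_ (col j) (col j′) →-dec (j ≟ j′)) j j′

induced-injective : ∀ P σ → Induces P σ → Injective _≡_ _≡_ σ
induced-injective P σ induces {j} {j′} σj≡σj′ = col-injective (·-injective P (begin
  P ·ℤ³ col j    ≡⟨ induces j ⟩
  col (σ j)      ≡⟨ cong col σj≡σj′ ⟩
  col (σ j′)     ≡⟨ induces j′ ⟨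
  P ·ℤ³ col j′   ∎))
  where open ≡-Reasoning

induced-permutation : ∀ P σ → Induces P σ → Permutation′ 18
induced-permutation P σ induces =
  permutation σ (proj₁ ∘ onto) (proj₂ ∘ onto) (λ j → σ-injective (proj₂ (onto (σ j))))
  where
  σ-injective : Injective _≡_ _≡_ σ
  σ-injective = induced-injective P σ induces
  onto : ∀ k → ∃ λ j → σ j ≡ k
  onto = injective⇒surjective σ-injective

A-induced : ∀ π ε σ → Induces (π , ε) σ → ∀ i j → A i (σ j) ≡ signℤ (ε i) * A (π ⟨$⟩ʳ i) j
A-induced π ε σ induces i j =
  trans (cong (λ c → lookup c i) (sym (induces j))) (·-lookup π ε (col j) i)

Aw-orbit : ∀ π ε σ {w v} → Induces (π , ε) σ → (∀ j → lookup v (σ j) ≡ lookup w j) →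
           ∀ i → Aw v i ≡ signℤ (ε i) * Aw w (π ⟨$⟩ʳ i)
Aw-orbit π ε σ {w} {v} induces v∘σ≗w i = begin
  Aw v i
    ≡⟨ Aw-sum v i ⟩
  sum (λ k → A i k * + lookup v k)
    ≡⟨ ∑ℤ.sum-permute (λ k → A i k * + lookup v k) (induced-permutation (π , ε) σ induces) ⟩
  sum (λ j → A i (σ j) * + lookup v (σ j))
    ≡⟨ ∑ℤ.sum-cong-≗ entry ⟩
  sum (λ j → signℤ (ε i) * (A (π ⟨$⟩ʳ i) j * + lookup w j))
    ≡⟨ ∑ℤ.*-distribˡ-sum (signℤ (ε i)) (λ j → A (π ⟨$⟩ʳ i) j * + lookup w j) ⟨
  signℤ (ε i) * sum (λ j → A (π ⟨$⟩ʳ i) j * + lookup w j)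
    ≡⟨ cong (signℤ (ε i) *_) (Aw-sum w (π ⟨$⟩ʳ i)) ⟨
  signℤ (ε i) * Aw w (π ⟨$⟩ʳ i)
    ∎
  where
  open ≡-Reasoning
  entry : ∀ j → A i (σ j) * + lookup v (σ j) ≡ signℤ (ε i) * (A (π ⟨$⟩ʳ i) j * + lookup w j)
  entry j = begin
    A i (σ j) * + lookup v (σ j)                  ≡⟨ cong₂ _*_ (A-induced π ε σ induces i j) (cong +_ (v∘σ≗w j)) ⟩
    signℤ (ε i) * A (π ⟨$⟩ʳ i) j * + lookup w j    ≡⟨ ℤP.*-assoc (signℤ (ε i)) _ _ ⟩
    signℤ (ε i) * (A (π ⟨$⟩ʳ i) j * + lookup w j)  ∎

InOrbit-InK : ∀ {w v} → InOrbit w v → InK w → InK v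
InOrbit-InK {w} {v} ((π , ε) , σ , induces , v∘σ≗w) Kw i = begin
  Aw v i                          ≡⟨ Aw-orbit π ε σ {w} {v} induces v∘σ≗w i ⟩
  signℤ (ε i) * Aw w (π ⟨$⟩ʳ i)   ≡⟨ cong (signℤ (ε i) *_) (Kw (π ⟨$⟩ʳ i)) ⟩
  signℤ (ε i) * + 0               ≡⟨ ℤP.*-zeroʳ (signℤ (ε i)) ⟩
  + 0                             ∎
  where open ≡-Reasoning

InOrbit⇒lookup : ∀ {w v} → InOrbit w v → ∀ k → ∃ λ j → lookup v k ≡ lookup w j
InOrbit⇒lookup {w} {v} (P , σ , induces , v∘σ≗w) k =
  ρ ⟨$⟩ˡ k , trans (cong (lookup v) (sym (inverseʳ ρ))) (v∘σ≗w (ρ ⟨$⟩ˡ k))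
  where
  ρ : Permutation′ 18
  ρ = induced-permutation P σ induces

InOrbit-zeroOne : ∀ {w v} → InOrbit w v → ZeroOne w → ZeroOne v
InOrbit-zeroOne {w} {v} v∈Gw w≤1 k =
  let j , vk≡wj = InOrbit⇒lookup {w} {v} v∈Gw k in subst (_≤ 1) (sym vk≡wj) (w≤1 j)

InOrbit-nonzero : ∀ {w v} → InOrbit w v → w ≢ zero¹⁸ → v ≢ zero¹⁸
InOrbit-nonzero {w} {v} (_ , σ , _ , v∘σ≗w) w≢0 v≡0 = w≢0 (lookup-ext λ j → begin
  lookup w j           ≡⟨ v∘σ≗w j ⟨
  lookup v (σ j)       ≡⟨ cong (λ x → lookup x (σ j)) v≡0 ⟩
  lookup zero¹⁸ (σ j)  ≡⟨ VecP.lookup-replicate (σ j) 0 ⟩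
  0                    ≡⟨ VecP.lookup-replicate j 0 ⟨
  lookup zero¹⁸ j      ∎)
  where open ≡-Reasoning

Nonzero01InK : ℕ¹⁸ → Set
Nonzero01InK w = ZeroOne w × InK w × w ≢ zero¹⁸

InOrbit-Nonzero01InK : ∀ {w v} → InOrbit w v → Nonzero01InK w → Nonzero01InK v
InOrbit-Nonzero01InK {w} {v} v∈Gw (w≤1 , Kw , w≢0) =
  InOrbit-zeroOne {w} {v} v∈Gw w≤1 , InOrbit-InK {w} {v} v∈Gw Kw , InOrbit-nonzero {w} {v} v∈Gw w≢0

Nonzero01InK-⊆supp⇒¬InH : ∀ {v u} → Nonzero01InK v → u ≢ v → v ⊆supp u → ¬ InH u
Nonzero01InK-⊆supp⇒¬InH {v} {u} (v≤1 , Kv , v≢0) u≢v v⊆u =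
  ¬InH-above {v} {u} Kv v≢0 (zeroOne-⊆supp⇒≼ {v} {u} v≤1 v⊆u) u≢v

reps-Nonzero01InK : All.All Nonzero01InK reps
reps-Nonzero01InK = from-yes (All.all? (λ w →
  FinP.all? (λ k → lookup w k ℕP.≤? 1) ×-dec
  FinP.all? (λ i → Aw w i ℤ.≟ + 0) ×-dec
  ¬? (VecP.≡-dec ℕP._≟_ w zero¹⁸)) reps)

theorem6 : (w : ℕ¹⁸) → w ∈ reps → (v : ℕ¹⁸) → InOrbit w v →
           (u : ℕ¹⁸) → ¬ (u ≡ v) → v ⊆supp u → ¬ InH u
theorem6 w w∈reps v v∈Gw u u≢v v⊆u =
  Nonzero01InK-⊆supp⇒¬InH {v} {u}
    (InOrbit-Nonzero01InK {w} {v} v∈Gw (All.lookup reps-Nonzero01InK w∈reps)) u≢v v⊆u
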